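{- If a connected graph $G$ has girth at least $4$, has order at least $3$ and has minimum degree $1$, then $G\Box K_2$ is not well-covered.
   Context: All graphs are finite and simple. A graph is well-covered if all its maximal independent sets have the same cardinality. The girth of a graph is the length of its shortest cycle ($\infty$ for forests). The Cartesian product $G \Box K_2$ has vertex set $V(G)\times\{1,2\}$, with $(g_1,i)$ adjacent to $(g_2,j)$ if either $g_1=g_2$ and $i\neq j$, or $i=j$ and $g_1g_2\in E(G)$. -}

module Defs where

open import Data.Nat using (ℕ; zero; suc; _*_; _≤_; _<_)
open import Data.Fin using (Fin; zero; suc; remQuot; inject₁; fromℕ)
open import Data.Fin.Subset using (Subset; _∈_; _∉_; _⊆_; ∣_∣)
open import Data.Bool using (Bool; true; false; _∧_; _∨_)
open import Data.Product using (Σ; ∃; _×_; _,_; proj₁; proj₂)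
open import Data.Vec using (tabulate)
open import Function.Definitions using (Injective)
open import Relation.Binary.PropositionalEquality using (_≡_; _≢_; refl)
open import Relation.Nullary using (¬_)

record Graph : Set where
  field
    order : ℕ
    adj   : Fin order → Fin order → Bool
    sym   : ∀ u v → adj u v ≡ adj v u
    irrefl : ∀ v → adj v v ≡ false

open Graph public

Adj : (G : Graph) → Fin (order G) → Fin (order G) → Set
Adj G u v = adj G u v ≡ true

nbhd : (G : Graph) → Fin (order G) → Subset (order G)
nbhd G v = tabulate (λ u → adj G v u)

degree : (G : Graph) → Fin (order G) → ℕ
degree G v = ∣ nbhd G v ∣

MinDegreeOne : Graph → Set
MinDegreeOne G = (∀ v → 1 ≤ degree G v) × (∃ λ v → degree G v ≡ 1)

Walk : (G : Graph) → Fin (order G) → Fin (order G) → ℕ → Set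
Walk G u v k = Σ (Fin (suc k) → Fin (order G)) λ w →
  (w zero ≡ u) × (w (fromℕ k) ≡ v) × (∀ (i : Fin k) → Adj G (w (inject₁ i)) (w (suc i)))

Connected : Graph → Set
Connected G = ∀ u v → ∃ λ k → Walk G u v k

-- a cycle of length (suc k): distinct vertices c 0, ..., c k with consecutive
-- ones adjacent and c k adjacent to c 0 (meaningful for suc k ≥ 3)
CycleOfLengthSuc : (G : Graph) → ℕ → Set
CycleOfLengthSuc G k = Σ (Fin (suc k) → Fin (order G)) λ c →
  Injective _≡_ _≡_ c ×
  (∀ (i : Fin k) → Adj G (c (inject₁ i)) (c (suc i))) ×
  Adj G (c (fromℕ k)) (c zero)

GirthAtLeast : Graph → ℕ → Set
GirthAtLeast G g = ∀ k → 3 ≤ suc k → suc k < g → ¬ CycleOfLengthSuc G k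

Independent : (G : Graph) → Subset (order G) → Set
Independent G S = ∀ u v → u ∈ S → v ∈ S → adj G u v ≡ false

MaximalIndependent : (G : Graph) → Subset (order G) → Set
MaximalIndependent G S = Independent G S × (∀ T → Independent G T → S ⊆ T → T ⊆ S)

WellCovered : Graph → Set
WellCovered G = ∀ S T → MaximalIndependent G S → MaximalIndependent G T → ∣ S ∣ ≡ ∣ T ∣

eqFin : ∀ {n} → Fin n → Fin n → Bool
eqFin zero zero = true
eqFin zero (suc _) = false
eqFin (suc _) zero = false
eqFin (suc i) (suc j) = eqFin i j

k2adj : Fin 2 → Fin 2 → Bool
k2adj i j = not (eqFin i j)
  where open import Data.Bool using (not)

-- Cartesian product G □ K₂ with vertex set Fin (order G * 2),
-- vertex (g , i) encoded as combine g i.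
pairAdj : (G : Graph) → Fin (order G) × Fin 2 → Fin (order G) × Fin 2 → Bool
pairAdj G (g₁ , i) (g₂ , j) = (eqFin g₁ g₂ ∧ k2adj i j) ∨ (eqFin i j ∧ adj G g₁ g₂)

□K₂-adj : (G : Graph) → Fin (order G * 2) → Fin (order G * 2) → Bool
□K₂-adj G x y = pairAdj G (remQuot 2 x) (remQuot 2 y)

eqFin-sym : ∀ {n} (i j : Fin n) → eqFin i j ≡ eqFin j i
eqFin-sym zero zero = refl
eqFin-sym zero (suc _) = refl
eqFin-sym (suc _) zero = refl
eqFin-sym (suc i) (suc j) = eqFin-sym i j

eqFin-refl : ∀ {n} (i : Fin n) → eqFin i i ≡ true
eqFin-refl zero = refl
eqFin-refl (suc i) = eqFin-refl i

□K₂-sym : (G : Graph) → ∀ x y → □K₂-adj G x y ≡ □K₂-adj G y x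
□K₂-sym G x y = pairSym (remQuot 2 x) (remQuot 2 y)
  where
  pairSym : ∀ p q → pairAdj G p q ≡ pairAdj G q p
  pairSym (g₁ , i) (g₂ , j) rewrite eqFin-sym g₁ g₂ | eqFin-sym i j | sym G g₁ g₂ = refl

□K₂-irrefl : (G : Graph) → ∀ x → □K₂-adj G x x ≡ false
□K₂-irrefl G x = pairIrr (remQuot 2 x)
  where
  pairIrr : ∀ p → pairAdj G p p ≡ false
  pairIrr (g , i) rewrite eqFin-refl g | eqFin-refl i | irrefl G g = refl

_□K₂ : Graph → Graph
G □K₂ = record
  { order = order G * 2
  ; adj = □K₂-adj G
  ; sym = □K₂-sym G
  ; irrefl = □K₂-irrefl G
  }

-- Let v be a vertex of degree 1 and u its neighbour. As G is connected of order at least 3,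
-- u has a neighbour x ≠ v, and girth at least 4 makes N(u) independent. In G □ K₂ the set
-- {(v,0)} ∪ {(y,1) | y ∈ N(u), y ≠ v} is therefore independent; extend it to a maximal
-- independent set M. The only neighbours of (v,0) are (v,1) and (u,0), which are nonadjacent and
-- have no neighbour in M besides (v,0): (u,1) is excluded by (x,1) ∈ M and each (y,0) by (y,1).
-- Exchanging (v,0) for these two vertices gives a maximal independent set of size |M| + 1.
module Submission where

open import Defs hiding (sym)
open import Data.Bool using (true; false; not; _∧_; _∨_)
import Data.Bool as Bool
open import Data.Bool.Properties using (¬-not; ∧-zeroʳ)
open import Data.Empty using (⊥-elim)
open import Data.Fin using (Fin; zero; suc; _≟_; combine; remQuot; inject₁)
open import Data.Fin.Patterns using (0F; 1F; 2F)
open import Data.Fin.Properties using (any?; remQuot-combine; combine-remQuot; suc-injective)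
open import Data.Fin.Subset using (Subset; _∈_; _∉_; _⊆_; ∣_∣; _∪_; _─_; _-_; ⁅_⁆; ⊥; ⊤; inside; outside)
open import Data.Fin.Subset.Properties
  using ( _∈?_; ∈⊤; ∣p∣≤n; ∣p∣≡n⇒p≡⊤; x∈⁅x⁆; x∈⁅y⁆⇒x≡y; p⊂q⇒∣p∣<∣q∣
        ; p⊆p∪q; x∈p∪q⁻; x∈p∪q⁺; p─⊥≡p; p─q⊆p; x∈p∧x≢y⇒x∈p-y)
open import Data.Nat using (ℕ; zero; suc; pred; _+_; _*_; _≤_; _<_; s≤s)
open import Data.Nat.Properties
  using (module ≤-Reasoning; ≤-refl; ≤-reflexive; ≤-trans; ≤-antisym; n≤1+n; m≤n+m; <⇒≢; +-identityʳ; +-suc; +-monoˡ-≤)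
open import Data.Product using (∃; ∃₂; _×_; _,_; proj₁; proj₂; uncurry)
open import Data.Product.Properties using (,-injective)
open import Data.Sum using (_⊎_; inj₁; inj₂; [_,_])
open import Data.Vec using (_∷_; []; there; tabulate)
open import Data.Vec.Properties using (lookup∘tabulate; []=⇒lookup; lookup⇒[]=)
open import Function using (_∘_; id)
open import Relation.Binary.PropositionalEquality using (_≡_; _≢_; refl; sym; trans; cong; cong₂; subst)
open import Relation.Nullary using (¬_; Dec; yes; no; does; Reflects; ofʸ; ofⁿ)
open import Relation.Nullary.Decidable using (decidable-stable; ¬?; _×-dec_; _⊎-dec_)
open import Relation.Unary using (Pred; Decidable)

private
  variable
    m n : ℕ
    x : Fin n
    p q : Subset n

⟪_⟫ : ∀ {ℓ} {P : Pred (Fin n) ℓ} → Decidable P → Subset n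
⟪ P? ⟫ = tabulate (does ∘ P?)

module _ {ℓ} {P : Pred (Fin n) ℓ} (P? : Decidable P) where

  ∈⟪⟫⁻ : x ∈ ⟪ P? ⟫ → P x
  ∈⟪⟫⁻ {x} x∈ with P? x | trans (sym (lookup∘tabulate _ x)) ([]=⇒lookup x∈)
  ... | yes px | _  = px
  ... | no _   | ()

  ∈⟪⟫⁺ : P x → x ∈ ⟪ P? ⟫
  ∈⟪⟫⁺ {x} px with P? x in eq
  ... | yes _  = lookup⇒[]= x _ (trans (lookup∘tabulate _ x) (cong does eq))
  ... | no ¬px = ⊥-elim (¬px px)

x∈p─q⇒x∉q : x ∈ p ─ q → x ∉ q
x∈p─q⇒x∉q {p = _ ∷ _} {q = outside ∷ _} (there x∈) (there x∈q) = x∈p─q⇒x∉q x∈ x∈q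
x∈p─q⇒x∉q {p = _ ∷ _} {q = inside  ∷ _} (there x∈) (there x∈q) = x∈p─q⇒x∉q x∈ x∈q

∣p∣≤suc∣p-x∣ : ∀ (p : Subset n) x → ∣ p ∣ ≤ suc ∣ p - x ∣
∣p∣≤suc∣p-x∣ (outside ∷ p) zero = subst (λ r → ∣ p ∣ ≤ suc ∣ r ∣) (sym (p─⊥≡p p)) (n≤1+n ∣ p ∣)
∣p∣≤suc∣p-x∣ (inside  ∷ p) zero = subst (λ r → suc ∣ p ∣ ≤ suc ∣ r ∣) (sym (p─⊥≡p p)) ≤-refl
∣p∣≤suc∣p-x∣ (outside ∷ p) (suc x) = ∣p∣≤suc∣p-x∣ p x
∣p∣≤suc∣p-x∣ (inside  ∷ p) (suc x) = s≤s (∣p∣≤suc∣p-x∣ p x)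

x∉p⇒∣p∣<∣p∪⁅x⁆∣ : x ∉ p → ∣ p ∣ < ∣ p ∪ ⁅ x ⁆ ∣
x∉p⇒∣p∣<∣p∪⁅x⁆∣ {x = x} x∉p = p⊂q⇒∣p∣<∣q∣ (p⊆p∪q _ , x , x∈p∪q⁺ (inj₂ (x∈⁅x⁆ x)) , x∉p)

∣p∣≡0⇒p≡⊥ : ∣ p ∣ ≡ 0 → p ≡ ⊥
∣p∣≡0⇒p≡⊥ {p = []} _ = refl
∣p∣≡0⇒p≡⊥ {p = outside ∷ p} eq = cong (outside ∷_) (∣p∣≡0⇒p≡⊥ eq)

∣p∣≡1⇒p≡⁅x⁆ : ∣ p ∣ ≡ 1 → ∃ λ x → p ≡ ⁅ x ⁆
∣p∣≡1⇒p≡⁅x⁆ {p = outside ∷ p} eq =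
  let (x , p≡⁅x⁆) = ∣p∣≡1⇒p≡⁅x⁆ eq in suc x , cong (outside ∷_) p≡⁅x⁆
∣p∣≡1⇒p≡⁅x⁆ {p = inside ∷ p} eq = zero , cong (inside ∷_) (∣p∣≡0⇒p≡⊥ (cong pred eq))

module _ (H : Graph) where

  private
    V = Fin (order H)

  Adj-sym : ∀ {u v : V} → Adj H u v → Adj H v u
  Adj-sym {u} {v} u~v = trans (Graph.sym H v u) u~v

  Adj⇒≢ : ∀ {u v : V} → Adj H u v → u ≢ v
  Adj⇒≢ {u} u~u refl with () ← trans (sym u~u) (irrefl H u)

  adj? : ∀ (u v : V) → Dec (Adj H u v)
  adj? u v = adj H u v Bool.≟ true

  ¬Adj⇒Independent : ∀ {S : Subset (order H)} → (∀ {u v} → u ∈ S → v ∈ S → ¬ Adj H u v) → Independent H S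
  ¬Adj⇒Independent noEdge u v u∈ v∈ = ¬-not (noEdge u∈ v∈)

  Independent⇒¬Adj : ∀ {S : Subset (order H)} → Independent H S → ∀ {u v} → u ∈ S → v ∈ S → ¬ Adj H u v
  Independent⇒¬Adj ind u∈ v∈ u~v with () ← trans (sym u~v) (ind _ _ u∈ v∈)

  Independent-⊆ : ∀ {S T : Subset (order H)} → S ⊆ T → Independent H T → Independent H S
  Independent-⊆ S⊆T ind u v u∈ v∈ = ind u v (S⊆T u∈) (S⊆T v∈)

  Independent-∪⁅⁆ : ∀ {S : Subset (order H)} {y} → Independent H S → (∀ {z} → z ∈ S → ¬ Adj H z y) →
                    Independent H (S ∪ ⁅ y ⁆)
  Independent-∪⁅⁆ {S} {y} ind y-isolated =
    ¬Adj⇒Independent λ u∈ v∈ → edgeless (x∈p∪q⁻ S ⁅ y ⁆ u∈) (x∈p∪q⁻ S ⁅ y ⁆ v∈)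
    where
    edgeless : ∀ {u v} → u ∈ S ⊎ u ∈ ⁅ y ⁆ → v ∈ S ⊎ v ∈ ⁅ y ⁆ → ¬ Adj H u v
    edgeless (inj₁ u∈) (inj₁ v∈) = Independent⇒¬Adj ind u∈ v∈
    edgeless (inj₁ u∈) (inj₂ v∈) rewrite x∈⁅y⁆⇒x≡y y v∈ = y-isolated u∈
    edgeless (inj₂ u∈) (inj₁ v∈) rewrite x∈⁅y⁆⇒x≡y y u∈ = y-isolated v∈ ∘ Adj-sym
    edgeless (inj₂ u∈) (inj₂ v∈) rewrite x∈⁅y⁆⇒x≡y y u∈ | x∈⁅y⁆⇒x≡y y v∈ = λ y~y → Adj⇒≢ y~y refl

  Dominating : Subset (order H) → Set
  Dominating S = ∀ y → y ∉ S → ∃ λ z → z ∈ S × Adj H y z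

  dominated? : ∀ (S : Subset (order H)) y → Dec (∃ λ z → z ∈ S × Adj H y z)
  dominated? S y = any? λ z → z ∈? S ×-dec adj? y z

  Independent-∪-undominated : ∀ {S y} → Independent H S → ¬ (∃ λ z → z ∈ S × Adj H y z) →
                              Independent H (S ∪ ⁅ y ⁆)
  Independent-∪-undominated ind undominated =
    Independent-∪⁅⁆ ind λ z∈ z~y → undominated (_ , z∈ , Adj-sym z~y)

  independent-dominating⇒maximal : ∀ {S} → Independent H S → Dominating S → MaximalIndependent H S
  independent-dominating⇒maximal {S} ind dom = ind , λ T indT S⊆T {y} y∈T →
    decidable-stable (y ∈? S) λ y∉S →
      let (z , z∈S , y~z) = dom y y∉S in Independent⇒¬Adj indT y∈T (S⊆T z∈S) y~z

  maximal⇒dominating : ∀ {M} → MaximalIndependent H M → Dominating M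
  maximal⇒dominating {M} (ind , maximal) y y∉M =
    decidable-stable (dominated? M y) λ undominated →
      y∉M (maximal (M ∪ ⁅ y ⁆) (Independent-∪-undominated ind undominated)
                   (p⊆p∪q _) (x∈p∪q⁺ (inj₂ (x∈⁅x⁆ y))))

  private
    -- Add undominated vertices one at a time; the fuel invariant makes running out impossible,
    -- since with no fuel left S is the whole vertex set.
    extend : ∀ k {S} → order H ≤ ∣ S ∣ + k → Independent H S → ∃ λ M → MaximalIndependent H M × S ⊆ M
    extend k {S} bound ind with any? (λ y → ¬? (y ∈? S) ×-dec ¬? (dominated? S y))
    ... | no none = S , independent-dominating⇒maximal ind dom , id
      where
      dom : Dominating S
      dom y y∉S = decidable-stable (dominated? S y) λ undominated → none (y , y∉S , undominated)
    extend zero {S} bound ind | yes (y , y∉S , _) = ⊥-elim (y∉S (subst (y ∈_) (sym S≡⊤) ∈⊤))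
      where
      S≡⊤ : S ≡ ⊤
      S≡⊤ = ∣p∣≡n⇒p≡⊤ (≤-antisym (∣p∣≤n S) (subst (_ ≤_) (+-identityʳ _) bound))
    extend (suc k) {S} bound ind | yes (y , y∉S , undominated) =
      let (M , maximal , S∪y⊆M) = extend k bound′ (Independent-∪-undominated ind undominated)
      in M , maximal , S∪y⊆M ∘ p⊆p∪q _
      where
      bound′ : order H ≤ ∣ S ∪ ⁅ y ⁆ ∣ + k
      bound′ = ≤-trans bound (≤-trans (≤-reflexive (+-suc ∣ S ∣ k))
                                      (+-monoˡ-≤ k (x∉p⇒∣p∣<∣p∪⁅x⁆∣ y∉S)))

  maximal-superset : ∀ {S} → Independent H S → ∃ λ M → MaximalIndependent H M × S ⊆ M
  maximal-superset = extend (order H) (m≤n+m _ _)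

module Exchange (H : Graph) {M : Subset (order H)} (M-maximal : MaximalIndependent H M)
  {a b c : Fin (order H)} (a∈M : a ∈ M) (a~b : Adj H a b) (a~c : Adj H a c)
  (N[a]⊆bc : ∀ {y} → Adj H a y → y ≡ b ⊎ y ≡ c) (b≢c : b ≢ c) (b≁c : ¬ Adj H b c)
  (N[b]∩M⊆a : ∀ {z} → z ∈ M → Adj H b z → z ≡ a)
  (N[c]∩M⊆a : ∀ {z} → z ∈ M → Adj H c z → z ≡ a) where

  private
    M-independent : Independent H M
    M-independent = proj₁ M-maximal

    b∉M : b ∉ M
    b∉M b∈M = Independent⇒¬Adj H M-independent a∈M b∈M a~b

    c∉M : c ∉ M
    c∉M c∈M = Independent⇒¬Adj H M-independent a∈M c∈M a~c

    ∈M-a⁻ : ∀ {z} → z ∈ M - a → z ∈ M × z ≢ a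
    ∈M-a⁻ {z} z∈ = p─q⊆p M ⁅ a ⁆ z∈ , λ { refl → x∈p─q⇒x∉q z∈ (x∈⁅x⁆ a) }

  T : Subset (order H)
  T = ((M - a) ∪ ⁅ b ⁆) ∪ ⁅ c ⁆

  private
    M-a⊆T : M - a ⊆ T
    M-a⊆T = p⊆p∪q _ ∘ p⊆p∪q _

    b∈T : b ∈ T
    b∈T = p⊆p∪q _ (x∈p∪q⁺ (inj₂ (x∈⁅x⁆ b)))

    c∈T : c ∈ T
    c∈T = x∈p∪q⁺ (inj₂ (x∈⁅x⁆ c))

  T-independent : Independent H T
  T-independent = Independent-∪⁅⁆ H (Independent-∪⁅⁆ H M-a-independent M-a≁b) M-a∪b≁c
    where
    M-a-independent : Independent H (M - a)
    M-a-independent = Independent-⊆ H (p─q⊆p M ⁅ a ⁆) M-independent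
    M-a≁b : ∀ {z} → z ∈ M - a → ¬ Adj H z b
    M-a≁b z∈ z~b = let (z∈M , z≢a) = ∈M-a⁻ z∈ in z≢a (N[b]∩M⊆a z∈M (Adj-sym H z~b))
    M-a∪b≁c : ∀ {z} → z ∈ (M - a) ∪ ⁅ b ⁆ → ¬ Adj H z c
    M-a∪b≁c z∈ with x∈p∪q⁻ (M - a) ⁅ b ⁆ z∈
    ... | inj₁ z∈M-a = λ z~c → let (z∈M , z≢a) = ∈M-a⁻ z∈M-a in z≢a (N[c]∩M⊆a z∈M (Adj-sym H z~c))
    ... | inj₂ z∈⁅b⁆ rewrite x∈⁅y⁆⇒x≡y b z∈⁅b⁆ = b≁c

  T-dominating : Dominating H T
  T-dominating y y∉T with y ≟ a
  ... | yes refl = b , b∈T , a~b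
  ... | no y≢a with maximal⇒dominating H M-maximal y (λ y∈M → y∉T (M-a⊆T (x∈p∧x≢y⇒x∈p-y y∈M y≢a)))
  ...   | z , z∈M , y~z with z ≟ a
  ...     | no z≢a = z , M-a⊆T (x∈p∧x≢y⇒x∈p-y z∈M z≢a) , y~z
  ...     | yes refl =
    ⊥-elim (y∉T ([ (λ { refl → b∈T }) , (λ { refl → c∈T }) ] (N[a]⊆bc (Adj-sym H y~z))))

  T-maximal : MaximalIndependent H T
  T-maximal = independent-dominating⇒maximal H T-independent T-dominating

  ∣M∣<∣T∣ : ∣ M ∣ < ∣ T ∣
  ∣M∣<∣T∣ = begin-strict
    ∣ M ∣                    ≤⟨ ∣p∣≤suc∣p-x∣ M a ⟩
    suc ∣ M - a ∣            ≤⟨ x∉p⇒∣p∣<∣p∪⁅x⁆∣ (b∉M ∘ p─q⊆p M ⁅ a ⁆) ⟩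
    ∣ (M - a) ∪ ⁅ b ⁆ ∣      <⟨ x∉p⇒∣p∣<∣p∪⁅x⁆∣ c∉M-a∪b ⟩
    ∣ T ∣                    ∎
    where
    open ≤-Reasoning
    c∉M-a∪b : c ∉ (M - a) ∪ ⁅ b ⁆
    c∉M-a∪b c∈ with x∈p∪q⁻ (M - a) ⁅ b ⁆ c∈
    ... | inj₁ c∈M-a = c∉M (p─q⊆p M ⁅ a ⁆ c∈M-a)
    ... | inj₂ c∈⁅b⁆ = b≢c (sym (x∈⁅y⁆⇒x≡y b c∈⁅b⁆))

  ¬wellCovered : ¬ WellCovered H
  ¬wellCovered wc = <⇒≢ ∣M∣<∣T∣ (wc M T M-maximal T-maximal)

TriangleFree : Graph → Set
TriangleFree G = ∀ {u x y} → Adj G u x → Adj G u y → ¬ Adj G x y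

girth≥4⇒triangle-free : ∀ G → GirthAtLeast G 4 → TriangleFree G
girth≥4⇒triangle-free G girth≥4 {u} {x} {y} u~x u~y x~y =
  girth≥4 2 ≤-refl ≤-refl (triangle , injective , edges , Adj-sym G u~y)
  where
  triangle : Fin 3 → Fin (order G)
  triangle 0F = u
  triangle 1F = x
  triangle 2F = y

  injective : ∀ {i j} → triangle i ≡ triangle j → i ≡ j
  injective {0F} {0F} _ = refl
  injective {0F} {1F} = ⊥-elim ∘ Adj⇒≢ G u~x
  injective {0F} {2F} = ⊥-elim ∘ Adj⇒≢ G u~y
  injective {1F} {0F} = ⊥-elim ∘ Adj⇒≢ G u~x ∘ sym
  injective {1F} {1F} _ = refl
  injective {1F} {2F} = ⊥-elim ∘ Adj⇒≢ G x~y
  injective {2F} {0F} = ⊥-elim ∘ Adj⇒≢ G u~y ∘ sym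
  injective {2F} {1F} = ⊥-elim ∘ Adj⇒≢ G x~y ∘ sym
  injective {2F} {2F} _ = refl

  edges : ∀ i → Adj G (triangle (inject₁ i)) (triangle (suc i))
  edges 0F = u~x
  edges 1F = x~y

degree≡1⇒unique-neighbour : ∀ G {v} → degree G v ≡ 1 → ∃ λ u → Adj G v u × (∀ {y} → Adj G v y → y ≡ u)
degree≡1⇒unique-neighbour G {v} deg≡1 with ∣p∣≡1⇒p≡⁅x⁆ {p = nbhd G v} deg≡1
... | u , N[v]≡⁅u⁆ =
  u , ∈nbhd⁻ (subst (u ∈_) (sym N[v]≡⁅u⁆) (x∈⁅x⁆ u)) ,
  λ v~y → x∈⁅y⁆⇒x≡y u (subst (_ ∈_) N[v]≡⁅u⁆ (∈nbhd⁺ v~y))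
  where
  ∈nbhd⁻ : ∀ {y} → y ∈ nbhd G v → Adj G v y
  ∈nbhd⁻ {y} y∈ = trans (sym (lookup∘tabulate _ y)) ([]=⇒lookup y∈)
  ∈nbhd⁺ : ∀ {y} → Adj G v y → y ∈ nbhd G v
  ∈nbhd⁺ {y} v~y = lookup⇒[]= y _ (trans (lookup∘tabulate _ y) v~y)

walk-crosses : ∀ G {ℓ} {P : Pred (Fin (order G)) ℓ} → Decidable P → ∀ {s t k} → Walk G s t k → P s → ¬ P t →
               ∃₂ λ p q → P p × ¬ P q × Adj G p q
walk-crosses G P? {k = zero} (w , refl , refl , _) Ps ¬Pt = ⊥-elim (¬Pt Ps)
walk-crosses G P? {k = suc k} (w , refl , refl , edges) Ps ¬Pt with P? (w 1F)
... | yes Pw₁ = walk-crosses G P? (w ∘ suc , refl , refl , edges ∘ suc) Pw₁ ¬Pt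
... | no ¬Pw₁ = w 0F , w 1F , Ps , ¬Pw₁ , edges 0F

third-element : 3 ≤ n → (u v : Fin n) → ∃ λ w → w ≢ u × w ≢ v
third-element (s≤s (s≤s (s≤s _))) 0F 0F = 1F , (λ ()) , (λ ())
third-element (s≤s (s≤s (s≤s _))) 0F 1F = 2F , (λ ()) , (λ ())
third-element (s≤s (s≤s (s≤s _))) 0F (suc (suc _)) = 1F , (λ ()) , (λ ())
third-element (s≤s (s≤s (s≤s _))) 1F 0F = 2F , (λ ()) , (λ ())
third-element (s≤s (s≤s (s≤s _))) (suc (suc _)) 0F = 1F , (λ ()) , (λ ())
third-element (s≤s (s≤s (s≤s _))) (suc _) (suc _) = 0F , (λ ()) , (λ ())

pendant-neighbour-has-other-neighbour : ∀ G → Connected G → 3 ≤ order G → ∀ {v u} → Adj G v u →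
  (∀ {y} → Adj G v y → y ≡ u) → ∃ λ x → Adj G u x × x ≢ v
pendant-neighbour-has-other-neighbour G connected 3≤n {v} {u} v~u leaf
  with third-element 3≤n u v
... | w , w≢u , w≢v
  with walk-crosses G (λ y → (y ≟ u) ⊎-dec (y ≟ v)) (proj₂ (connected v w)) (inj₂ refl) [ w≢u , w≢v ]
...   | p , q , inj₁ refl , q∉uv , u~q = q , u~q , q∉uv ∘ inj₂
...   | p , q , inj₂ refl , q∉uv , v~q = ⊥-elim (q∉uv (inj₁ (leaf v~q)))

combine-injective : ∀ {n} {i k : Fin m} {j l : Fin n} → combine i j ≡ combine k l → i ≡ k × j ≡ l
combine-injective {n = n} {i} {k} {j} {l} eq =
  ,-injective (trans (sym (remQuot-combine i j)) (trans (cong (remQuot n) eq) (remQuot-combine k l)))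

data Combined {m n : ℕ} : Fin (m * n) → Set where
  combined : ∀ (i : Fin m) (j : Fin n) → Combined (combine i j)

combined-view : ∀ n (z : Fin (m * n)) → Combined z
combined-view {m} n z = subst (Combined {m} {n}) (combine-remQuot {m} n z) (combined _ _)

eqFin-reflects : ∀ (i j : Fin n) → Reflects (i ≡ j) (eqFin i j)
eqFin-reflects 0F 0F = ofʸ refl
eqFin-reflects 0F (suc j) = ofⁿ λ ()
eqFin-reflects (suc i) 0F = ofⁿ λ ()
eqFin-reflects (suc i) (suc j) with eqFin i j | eqFin-reflects i j
... | true  | ofʸ refl = ofʸ refl
... | false | ofⁿ i≢j = ofⁿ (i≢j ∘ suc-injective)

module _ (G : Graph) {g h : Fin (order G)} {i j : Fin 2} where

  private
    □K₂-adj-combine : adj (G □K₂) (combine g i) (combine h j) ≡ pairAdj G (g , i) (h , j)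
    □K₂-adj-combine = cong₂ (pairAdj G) (remQuot-combine g i) (remQuot-combine h j)

  □K₂-Adj⁻ : Adj (G □K₂) (combine g i) (combine h j) → g ≡ h × i ≢ j ⊎ i ≡ j × Adj G g h
  □K₂-Adj⁻ g~h = pairAdj⁻ (trans (sym □K₂-adj-combine) g~h)
    where
    pairAdj⁻ : (eqFin g h ∧ not (eqFin i j)) ∨ (eqFin i j ∧ adj G g h) ≡ true →
               g ≡ h × i ≢ j ⊎ i ≡ j × Adj G g h
    pairAdj⁻ with eqFin g h | eqFin-reflects g h | eqFin i j | eqFin-reflects i j
    ... | true  | ofʸ g≡h | false | ofⁿ i≢j = λ _ → inj₁ (g≡h , i≢j)
    ... | true  | _       | true  | ofʸ i≡j = λ g~h → inj₂ (i≡j , g~h)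
    ... | false | _       | true  | ofʸ i≡j = λ g~h → inj₂ (i≡j , g~h)
    ... | false | _       | false | _       = λ ()

module _ (G : Graph) where

  □K₂-rung : ∀ g → Adj (G □K₂) (combine g 0F) (combine g 1F)
  □K₂-rung g = trans (cong₂ (pairAdj G) (remQuot-combine g 0F) (remQuot-combine g 1F)) rung
    where
    rung : pairAdj G (g , 0F) (g , 1F) ≡ true
    rung rewrite eqFin-refl g = refl

  □K₂-layer : ∀ {g h} i → Adj G g h → Adj (G □K₂) (combine g i) (combine h i)
  □K₂-layer {g} {h} i g~h = trans (cong₂ (pairAdj G) (remQuot-combine g i) (remQuot-combine h i)) layer
    where
    layer : pairAdj G (g , i) (h , i) ≡ true
    layer rewrite eqFin-refl i | ∧-zeroʳ (eqFin g h) = g~h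

module PendantSquare (G : Graph) {v u x : Fin (order G)} (v~u : Adj G v u) (leaf : ∀ {y} → Adj G v y → y ≡ u)
  (u~x : Adj G u x) (x≢v : x ≢ v) (triangle-free : TriangleFree G) where

  private
    H = G □K₂

    view : ∀ z → Combined {order G} {2} z
    view = combined-view 2

  data Seed : Fin (order G) → Fin 2 → Set where
    pendant₀   : Seed v 0F
    neighbour₁ : ∀ {y} → Adj G u y → y ≢ v → Seed y 1F

  seed? : ∀ g i → Dec (Seed g i)
  seed? g 0F with g ≟ v
  ... | yes refl = yes pendant₀
  ... | no g≢v   = no λ { pendant₀ → g≢v refl }
  seed? g 1F with adj? G u g | g ≟ v
  ... | yes u~g  | no g≢v   = yes (neighbour₁ u~g g≢v)
  ... | yes _    | yes refl = no λ { (neighbour₁ _ v≢v) → v≢v refl }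
  ... | no ¬u~g  | _        = no λ { (neighbour₁ u~g _) → ¬u~g u~g }

  A? : ∀ z → Dec (uncurry Seed (remQuot 2 z))
  A? z = uncurry seed? (remQuot 2 z)

  A : Subset (order H)
  A = ⟪ A? ⟫

  ∈A⁻ : ∀ {g i} → combine g i ∈ A → Seed g i
  ∈A⁻ {g} {i} z∈A = subst (uncurry Seed) (remQuot-combine g i) (∈⟪⟫⁻ A? z∈A)

  ∈A⁺ : ∀ {g i} → Seed g i → combine g i ∈ A
  ∈A⁺ {g} {i} s = ∈⟪⟫⁺ A? (subst (uncurry Seed) (sym (remQuot-combine g i)) s)

  seeds-nonadjacent : ∀ {g h i j} → Seed g i → Seed h j → ¬ Adj H (combine g i) (combine h j)
  seeds-nonadjacent s t e with s | t | □K₂-Adj⁻ G e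
  ... | pendant₀         | pendant₀          | _                     = Adj⇒≢ H e refl
  ... | pendant₀         | neighbour₁ _ y≢v  | inj₁ (v≡y , _)        = y≢v (sym v≡y)
  ... | neighbour₁ _ y≢v | pendant₀          | inj₁ (y≡v , _)        = y≢v y≡v
  ... | neighbour₁ _ _   | neighbour₁ _ _    | inj₁ (_ , 1≢1)        = 1≢1 refl
  ... | neighbour₁ u~y _ | neighbour₁ u~y′ _ | inj₂ (_ , y~y′)       = triangle-free u~y u~y′ y~y′

  A-independent : Independent H A
  A-independent = ¬Adj⇒Independent H λ {z} {z′} → nonadjacent (view z) (view z′)
    where
    nonadjacent : ∀ {z z′} → Combined {order G} {2} z → Combined {order G} {2} z′ → z ∈ A → z′ ∈ A → ¬ Adj H z z′
    nonadjacent (combined g i) (combined h j) z∈A z′∈A = seeds-nonadjacent (∈A⁻ z∈A) (∈A⁻ z′∈A)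

  private
    extension : ∃ λ M → MaximalIndependent H M × A ⊆ M
    extension = maximal-superset H A-independent

  M : Subset (order H)
  M = proj₁ extension

  M-maximal : MaximalIndependent H M
  M-maximal = proj₁ (proj₂ extension)

  seed∈M : ∀ {g i} → Seed g i → combine g i ∈ M
  seed∈M = proj₂ (proj₂ extension) ∘ ∈A⁺

  adjacent-to-seed⇒∉M : ∀ {z g i} → Seed g i → Adj H z (combine g i) → z ∉ M
  adjacent-to-seed⇒∉M s z~s z∈M = Independent⇒¬Adj H (proj₁ M-maximal) z∈M (seed∈M s) z~s

  u₁∉M : combine u 1F ∉ M
  u₁∉M = adjacent-to-seed⇒∉M (neighbour₁ u~x x≢v) (□K₂-layer G 1F u~x)

  a b c : Fin (order H)
  a = combine v 0F
  b = combine v 1F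
  c = combine u 0F

  N[a]⊆bc : ∀ {z} → Adj H a z → z ≡ b ⊎ z ≡ c
  N[a]⊆bc {z} a~z with view z
  ... | combined h j with □K₂-Adj⁻ G a~z
  ...   | inj₁ (refl , 0≢j) with j
  ...     | 0F = ⊥-elim (0≢j refl)
  ...     | 1F = inj₁ refl
  N[a]⊆bc {z} a~z | combined h j | inj₂ (refl , v~h) = inj₂ (cong (λ g → combine g 0F) (leaf v~h))

  N[b]∩M⊆a : ∀ {z} → z ∈ M → Adj H b z → z ≡ a
  N[b]∩M⊆a {z} z∈M b~z with view z
  ... | combined h j with □K₂-Adj⁻ G b~z
  ...   | inj₁ (refl , 1≢j) with j
  ...     | 0F = refl
  ...     | 1F = ⊥-elim (1≢j refl)
  N[b]∩M⊆a {z} z∈M b~z | combined h j | inj₂ (refl , v~h) rewrite leaf v~h = ⊥-elim (u₁∉M z∈M)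

  N[c]∩M⊆a : ∀ {z} → z ∈ M → Adj H c z → z ≡ a
  N[c]∩M⊆a {z} z∈M c~z with view z
  ... | combined h j with □K₂-Adj⁻ G c~z
  ...   | inj₁ (refl , 0≢j) with j
  ...     | 0F = ⊥-elim (0≢j refl)
  ...     | 1F = ⊥-elim (u₁∉M z∈M)
  N[c]∩M⊆a {z} z∈M c~z | combined h j | inj₂ (refl , u~h) with h ≟ v
  ...   | yes refl = refl
  ...   | no h≢v   = ⊥-elim (adjacent-to-seed⇒∉M (neighbour₁ u~h h≢v) (□K₂-rung G h) z∈M)

  ¬wellCovered : ¬ WellCovered H
  ¬wellCovered =
    Exchange.¬wellCovered H M-maximal (seed∈M pendant₀) (□K₂-rung G v) (□K₂-layer G 0F v~u)
      N[a]⊆bc b≢c b≁c N[b]∩M⊆a N[c]∩M⊆a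
    where
    b≢c : b ≢ c
    b≢c b≡c with () ← proj₂ (combine-injective {m = order G} b≡c)
    b≁c : ¬ Adj H b c
    b≁c b~c with □K₂-Adj⁻ G b~c
    ... | inj₁ (v≡u , _) = Adj⇒≢ G v~u v≡u
    ... | inj₂ (() , _)

corollary3p7 : (G : Graph) → Connected G → GirthAtLeast G 4 → 3 ≤ order G →
    MinDegreeOne G → ¬ WellCovered (G □K₂)
corollary3p7 G connected girth≥4 3≤n (_ , v , deg[v]≡1) =
  let (u , v~u , leaf) = degree≡1⇒unique-neighbour G deg[v]≡1
      (x , u~x , x≢v) = pendant-neighbour-has-other-neighbour G connected 3≤n v~u leaf
  in PendantSquare.¬wellCovered G v~u leaf u~x x≢v (girth≥4⇒triangle-free G girth≥4)
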